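{- Let $n \geq 4$ be a natural number and let $f_n = f_n(x_1, \ldots, x_n)$ be the Boolean function on $\{0,1\}^n$ given by the DNF $$x_1 x_2 \vee x_1 x_3 \vee \dots \vee x_1 x_{n-1} \vee x_2 x_3 \cdots x_n .$$ Then $f_n$ is a positive threshold function which depends on all its variables and is not linear read-once (in particular not nested), and the specification number of $f_n$ in the class $\mathcal{H}_n$ of threshold Boolean functions of $n$ variables is $n+1$.
   Context: A Boolean function $f$ on $B^n=\{0,1\}^n$ is a threshold function if there are reals $w_1,\dots,w_n,t$ such that for all $x\in B^n$, $f(x)=0$ iff $\sum_i w_i x_i \le t$. $\mathcal{H}_n$ denotes the class of threshold Boolean functions of $n$ variables. $f$ is positive if $f(x)=1$ and $x\le y$ coordinatewise imply $f(y)=1$. A variable $x_k$ is relevant for $f$ if $f_{|x_k=1}\not\equiv f_{|x_k=0}$ (restriction obtained by fixing $x_k$). A Boolean function is linear read-once if it is constant or representable by a nested formula, defined recursively: the literals $x$ and $\bar{x}$ are nested formulas; if $t$ is a nested formula containing neither $x$ nor $\bar x$, then $x\vee t$, $x\wedge t$, $\bar x\vee t$, $\bar x\wedge t$ are nested formulas. A linear read-once function depending on all its variables is called nested. For a class $\mathcal{F}$ of functions of $n$ variables and $f\in\mathcal{F}$, a set $S\subseteq B^n$ specifies $f$ in $\mathcal{F}$ if $f$ is the only function in $\mathcal{F}$ agreeing with $f$ on $S$; the specification number $\sigma_{\mathcal{F}}(f)$ is the minimum cardinality of such a set.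
   Formalization: Threshold functions, including those of the class $\mathcal{H}_n$ in which the specification number is taken, have rational weights and threshold instead of real ones. -}

module Defs where

open import Data.Bool using (Bool; true; false; _∧_; _∨_; not; if_then_else_)
open import Data.Nat using (ℕ; zero; suc; _≤_)
open import Data.Fin using (Fin)
open import Data.Vec using (Vec; []; _∷_; _[_]≔_)
open import Data.List using (List; []; _∷_; _++_; length)
open import Data.List.Membership.Propositional using (_∈_; _∉_)
open import Data.List.Relation.Unary.Unique.Propositional using (Unique)
open import Data.Rational using (ℚ; 0ℚ; _+_) renaming (_≤_ to _≤ℚ_)
open import Data.Product using (Σ; ∃; _×_; _,_)
open import Data.Sum using (_⊎_)
open import Relation.Binary.PropositionalEquality using (_≡_)
open import Relation.Nullary using (¬_)
open import Function.Bundles using (_⇔_)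

B : ℕ → Set
B n = Vec Bool n

BoolFun : ℕ → Set
BoolFun n = B n → Bool

_≗f_ : ∀ {n} → BoolFun n → BoolFun n → Set
f ≗f g = ∀ x → f x ≡ g x

dot : ∀ {n} → Vec ℚ n → B n → ℚ
dot [] [] = 0ℚ
dot (w ∷ ws) (b ∷ bs) = (if b then w else 0ℚ) + dot ws bs

IsThreshold : ∀ {n} → BoolFun n → Set
IsThreshold {n} f = Σ (Vec ℚ n) λ w → Σ ℚ λ t → ∀ x → (f x ≡ false) ⇔ (dot w x ≤ℚ t)

_≤B_ : ∀ {n} → B n → B n → Set
[] ≤B [] = Data.Unit.⊤ where import Data.Unit
(a ∷ as) ≤B (b ∷ bs) = (a ≡ true → b ≡ true) × (as ≤B bs)

IsPositive : ∀ {n} → BoolFun n → Set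
IsPositive f = ∀ x y → x ≤B y → f x ≡ true → f y ≡ true

restrict : ∀ {n} → BoolFun n → Fin n → Bool → BoolFun n
restrict f k b x = f (x [ k ]≔ b)

Relevant : ∀ {n} → BoolFun n → Fin n → Set
Relevant f k = ¬ (restrict f k true ≗f restrict f k false)

DependsOnAll : ∀ {n} → BoolFun n → Set
DependsOnAll f = ∀ k → Relevant f k

-- Nested formulas.  A literal is (variable, polarity): polarity true = x, false = x̄.
data Op : Set where
  OR AND : Op

data Formula (n : ℕ) : Set where
  lit  : Fin n → Bool → Formula n
  node : Fin n → Bool → Op → Formula n → Formula n

vars : ∀ {n} → Formula n → List (Fin n)
vars (lit i _) = i ∷ []
vars (node i _ _ t) = i ∷ vars t

IsNestedFormula : ∀ {n} → Formula n → Set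
IsNestedFormula (lit i _) = Data.Unit.⊤ where import Data.Unit
IsNestedFormula (node i _ _ t) = (i ∉ vars t) × IsNestedFormula t

litVal : ∀ {n} → Fin n → Bool → B n → Bool
litVal i true x = Data.Vec.lookup x i
litVal i false x = not (Data.Vec.lookup x i)

opVal : Op → Bool → Bool → Bool
opVal OR a b = a ∨ b
opVal AND a b = a ∧ b

eval : ∀ {n} → Formula n → B n → Bool
eval (lit i p) x = litVal i p x
eval (node i p o t) x = opVal o (litVal i p x) (eval t x)

IsLinearReadOnce : ∀ {n} → BoolFun n → Set
IsLinearReadOnce f =
  (Σ Bool λ c → ∀ x → f x ≡ c)
  ⊎ (Σ _ λ φ → IsNestedFormula φ × (f ≗f eval φ))

IsNested : ∀ {n} → BoolFun n → Set
IsNested f = IsLinearReadOnce f × DependsOnAll f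

Specifies : ∀ {n} → (BoolFun n → Set) → List (B n) → BoolFun n → Set
Specifies C S f = ∀ g → C g → (∀ x → x ∈ S → g x ≡ f x) → g ≗f f

-- σ_C(f) = m : some set (duplicate-free list) of size m specifies f, and every
-- specifying set has at least m elements.
SpecNumber : ∀ {n} → (BoolFun n → Set) → BoolFun n → ℕ → Set
SpecNumber C f m =
  (Σ (List _) λ S → Unique S × length S ≡ m × Specifies C S f)
  × (∀ S → Unique S → Specifies C S f → m ≤ length S)

-- The function f_n (0-indexed: x_1 is position 0).
-- orInit bs = disjunction of all entries of bs except the last one.
orInit : ∀ {m} → Vec Bool m → Bool
orInit [] = false
orInit (b ∷ []) = false
orInit (b ∷ c ∷ bs) = b ∨ orInit (c ∷ bs)

andAll : ∀ {m} → Vec Bool m → Bool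
andAll [] = true
andAll (b ∷ bs) = b ∧ andAll bs

fn : ∀ n → BoolFun n
fn zero [] = false
fn (suc m) (x₁ ∷ rest) = (x₁ ∧ orInit rest) ∨ andAll rest

{-# OPTIONS --safe #-}
-- Write a point as ⟨ x₁ ∣ xs ∣ xₙ ⟩ with m = n − 2 middle coordinates. The minimal true points of f are
-- 𝐀 i = ⟨ 1 ∣ eᵢ ∣ 0 ⟩ and 𝐁 = ⟨ 0 ∣ 1⋯1 ∣ 1 ⟩, its maximal false points are 𝐂 = ⟨ 1 ∣ 0⋯0 ∣ 1 ⟩,
-- 𝐃 = ⟨ 0 ∣ 1⋯1 ∣ 0 ⟩ and 𝐄 i = ⟨ 0 ∣ 1⋯1 − eᵢ ∣ 1 ⟩. So nonnegative weights putting the former strictly above a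
-- threshold and the latter at or below it realise f, which makes f positive and threshold.
-- Upper bound: a threshold function agreeing with f on S = {𝐀 i, 𝐁, 𝐂, 𝐃} must have nonnegative weights with
-- the last weight below every middle one; this puts every 𝐄 i below 𝐃, so the function is f.
-- Lower bound: for each p ∈ S there are integral weights making p the unique lightest true or heaviest false
-- point, so moving the threshold by one flips f exactly at p and keeps it threshold; every specifying set
-- therefore contains S.
-- f is not read-once: it vanishes at 0⋯0 and at each unit vector, is 1 at 1⋯1, and each variable is 0 at some
-- true point.
module Submission where

open import Defs
open import Data.Nat using (ℕ; _≤_; suc)
open import Data.Product using (_×_)
open import Relation.Nullary using (¬_)

open import Algebra.Bundles using (CommutativeMonoid)
open import Data.Bool using (Bool; true; false; _∧_; _∨_; not; if_then_else_)
open import Data.Bool.Properties using (∧-conicalˡ; ∧-conicalʳ; ∨-conicalˡ; ∧-zeroʳ; ∧-identityʳ; ¬-not; not-¬)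
import Data.Bool.Properties as Boolₚ
open import Data.Empty using (⊥)
open import Data.Fin using (Fin; zero; suc; inject₁; fromℕ)
import Data.Fin.Properties as Finₚ
open import Data.Fin.Relation.Unary.Top using (view; ‵fromℕ; ‵inject₁)
import Data.Integer as ℤ
open import Data.List using (List; []; _∷_; length; tabulate)
open import Data.List.Membership.Propositional using (_∈_)
open import Data.List.Membership.Propositional.Properties using (∈-tabulate⁺; ∈-tabulate⁻)
open import Data.List.Properties using (length-tabulate; length-removeAt′)
import Data.List.Relation.Unary.All as ListAll
import Data.List.Relation.Unary.All.Properties as ListAllₚ
open import Data.List.Relation.Unary.AllPairs using (_∷_)
open import Data.List.Relation.Unary.Any using (here; there; any?; _─_; index)
open import Data.List.Relation.Unary.Unique.Propositional using (Unique)
import Data.List.Relation.Unary.Unique.Propositional.Properties as Uniqueₚ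
open import Data.Nat using (zero; z≤n; s≤s)
open import Data.Product using (∃; _,_; proj₁; proj₂)
open import Data.Rational using (ℚ; 0ℚ; 1ℚ; _+_) renaming (_≤_ to _≤ℚ_; _<_ to _<ℚ_)
open import Data.Rational.Literals using (fromℤ)
import Data.Rational.Properties as ℚₚ
open import Data.Sum using (_⊎_; inj₁; inj₂)
open import Data.Vec using (Vec; []; _∷_; _∷ʳ_; replicate; lookup; _[_]≔_; initLast)
import Data.Vec.Properties as Vecₚ
open import Data.Vec.Relation.Unary.All using (All; []; _∷_)
import Data.Vec.Relation.Unary.All as All
open import Data.Vec.Relation.Unary.All.Properties using (lookup⁻)
open import Function using (id; _∘_)
open import Function.Bundles using (_⇔_; mk⇔; Equivalence)
open import Relation.Binary.PropositionalEquality
open import Relation.Nullary using (Dec; yes; no; does; contradiction)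
open import Relation.Nullary.Decidable using (True; toWitness)

open import Algebra.Properties.CommutativeSemigroup
  (CommutativeMonoid.commutativeSemigroup ℚₚ.+-0-commutativeMonoid)
  using (x∙yz≈y∙xz)

ι : ℕ → ℚ
ι n = fromℤ (ℤ.+ n)

decide-≤ : ∀ {p q} {p≤q : True (p ℚₚ.≤? q)} → p ≤ℚ q
decide-≤ {p≤q = p≤q} = toWitness p≤q

decide-< : ∀ {p q} {p<q : True (p ℚₚ.<? q)} → p <ℚ q
decide-< {p<q = p<q} = toWitness p<q

module _ (r : ℚ) {p q s s′ : ℚ} (s≡r+p : s ≡ r + p) (s′≡r+q : s′ ≡ r + q) where

  offset-≤ : {p≤q : True (p ℚₚ.≤? q)} → s ≤ℚ s′
  offset-≤ {p≤q} = subst₂ _≤ℚ_ (sym s≡r+p) (sym s′≡r+q) (ℚₚ.+-monoʳ-≤ r (toWitness p≤q))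

  offset-< : {p<q : True (p ℚₚ.<? q)} → s <ℚ s′
  offset-< {p<q} = subst₂ _<ℚ_ (sym s≡r+p) (sym s′≡r+q) (ℚₚ.+-monoʳ-< r (toWitness p<q))

<⇒≱ : ∀ {p q} → p <ℚ q → ¬ (q ≤ℚ p)
<⇒≱ p<q q≤p = ℚₚ.<-irrefl refl (ℚₚ.<-≤-trans p<q q≤p)

+-cancelˡ-≤ : ∀ r {p q} → r + p ≤ℚ r + q → p ≤ℚ q
+-cancelˡ-≤ r r+p≤r+q = ℚₚ.≮⇒≥ (λ q<p → <⇒≱ (ℚₚ.+-monoʳ-< r q<p) r+p≤r+q)

+-cancelˡ-< : ∀ r {p q} → r + p <ℚ r + q → p <ℚ q
+-cancelˡ-< r r+p<r+q = ℚₚ.≰⇒> (λ q≤p → <⇒≱ r+p<r+q (ℚₚ.+-monoʳ-≤ r q≤p))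

1+-monoʳ-≤ : ∀ r p {q} → 1ℚ + p ≤ℚ q → 1ℚ + (r + p) ≤ℚ r + q
1+-monoʳ-≤ r p 1+p≤q = ℚₚ.≤-trans (ℚₚ.≤-reflexive (x∙yz≈y∙xz 1ℚ r p)) (ℚₚ.+-monoʳ-≤ r 1+p≤q)

ones zeros : ∀ {n} → Vec Bool n
ones = replicate _ true
zeros = replicate _ false

unit : ∀ {n} → Fin n → Vec Bool n
unit i = zeros [ i ]≔ true

orAll : ∀ {n} → Vec Bool n → Bool
orAll [] = false
orAll (b ∷ bs) = b ∨ orAll bs

replicate-[]≔ : ∀ {A : Set} n (a : A) (i : Fin n) → replicate n a [ i ]≔ a ≡ replicate n a
replicate-[]≔ n a i =
  trans (cong (replicate n a [ i ]≔_) (sym (Vecₚ.lookup-replicate i a))) (Vecₚ.[]≔-lookup (replicate n a) i)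

replicate-∷ʳ : ∀ {A : Set} n (a : A) → replicate (suc n) a ≡ replicate n a ∷ʳ a
replicate-∷ʳ zero a = refl
replicate-∷ʳ (suc n) a = cong (a ∷_) (replicate-∷ʳ n a)

lookup-∷ʳ-inject₁ : ∀ {A : Set} {n} (xs : Vec A n) x i → lookup (xs ∷ʳ x) (inject₁ i) ≡ lookup xs i
lookup-∷ʳ-inject₁ (y ∷ xs) x zero = refl
lookup-∷ʳ-inject₁ (y ∷ xs) x (suc i) = lookup-∷ʳ-inject₁ xs x i

lookup-∷ʳ-fromℕ : ∀ {A : Set} {n} (xs : Vec A n) x → lookup (xs ∷ʳ x) (fromℕ n) ≡ x
lookup-∷ʳ-fromℕ [] x = refl
lookup-∷ʳ-fromℕ (y ∷ xs) x = lookup-∷ʳ-fromℕ xs x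

[]≔-∷ʳ-inject₁ : ∀ {A : Set} {n} (xs : Vec A n) x i y → (xs ∷ʳ x) [ inject₁ i ]≔ y ≡ (xs [ i ]≔ y) ∷ʳ x
[]≔-∷ʳ-inject₁ (z ∷ xs) x zero y = refl
[]≔-∷ʳ-inject₁ (z ∷ xs) x (suc i) y = cong (z ∷_) ([]≔-∷ʳ-inject₁ xs x i y)

[]≔-∷ʳ-fromℕ : ∀ {A : Set} {n} (xs : Vec A n) x y → (xs ∷ʳ x) [ fromℕ n ]≔ y ≡ xs ∷ʳ y
[]≔-∷ʳ-fromℕ [] x y = refl
[]≔-∷ʳ-fromℕ (z ∷ xs) x y = cong (z ∷_) ([]≔-∷ʳ-fromℕ xs x y)

All-∷ʳ : ∀ {A : Set} {P : A → Set} {n} {xs : Vec A n} {x} → All P xs → P x → All P (xs ∷ʳ x)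
All-∷ʳ [] px = px ∷ []
All-∷ʳ (py ∷ pxs) px = py ∷ All-∷ʳ pxs px

unit-injective : ∀ {n} {i j : Fin n} → unit i ≡ unit j → i ≡ j
unit-injective {i = zero} {zero} _ = refl
unit-injective {i = suc i} {suc j} eq = cong suc (unit-injective (Vecₚ.∷-injectiveʳ eq))

lookup-unit-≢ : ∀ {n} {i j : Fin n} → j ≢ i → lookup (unit i) j ≡ false
lookup-unit-≢ {i = i} {j} j≢i = trans (Vecₚ.lookup∘update′ j≢i zeros true) (Vecₚ.lookup-replicate j false)

orAll-zeros : ∀ n → orAll (replicate n false) ≡ false
orAll-zeros zero = refl
orAll-zeros (suc n) = orAll-zeros n

orAll-unit : ∀ {n} (i : Fin n) → orAll (unit i) ≡ true
orAll-unit zero = refl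
orAll-unit (suc i) = orAll-unit i

andAll-ones : ∀ n → andAll (replicate n true) ≡ true
andAll-ones zero = refl
andAll-ones (suc n) = andAll-ones n

orInit-∷ʳ : ∀ {n} (xs : Vec Bool n) x → orInit (xs ∷ʳ x) ≡ orAll xs
orInit-∷ʳ [] x = refl
orInit-∷ʳ (y ∷ []) x = refl
orInit-∷ʳ (y ∷ z ∷ xs) x = cong (y ∨_) (orInit-∷ʳ (z ∷ xs) x)

andAll-∷ʳ : ∀ {n} (xs : Vec Bool n) x → andAll (xs ∷ʳ x) ≡ andAll xs ∧ x
andAll-∷ʳ [] x = ∧-identityʳ x
andAll-∷ʳ (true ∷ xs) x = andAll-∷ʳ xs x
andAll-∷ʳ (false ∷ xs) x = refl

≤B-zeros : ∀ {n} (x : B n) → zeros ≤B x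
≤B-zeros [] = _
≤B-zeros (a ∷ x) = (λ ()) , ≤B-zeros x

≤B-ones : ∀ {n} (x : B n) → x ≤B ones
≤B-ones [] = _
≤B-ones (a ∷ x) = (λ _ → refl) , ≤B-ones x

≤B-∷ʳ : ∀ {n} {x y : B n} {a b} → x ≤B y → (a ≡ true → b ≡ true) → (x ∷ʳ a) ≤B (y ∷ʳ b)
≤B-∷ʳ {x = []} {[]} _ a≤b = a≤b , _
≤B-∷ʳ {x = _ ∷ _} {_ ∷ _} (c≤d , x≤y) a≤b = c≤d , ≤B-∷ʳ x≤y a≤b

orAll-true-≤B : ∀ {n} (x : B n) → orAll x ≡ true → ∃ λ i → unit i ≤B x
orAll-true-≤B (true ∷ x) _ = zero , id , ≤B-zeros x
orAll-true-≤B (false ∷ x) any = let i , uᵢ≤x = orAll-true-≤B x any in suc i , id , uᵢ≤x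

orAll-false-≤B : ∀ {n} (x : B n) → orAll x ≡ false → x ≤B zeros
orAll-false-≤B [] _ = _
orAll-false-≤B (false ∷ x) none = id , orAll-false-≤B x none

andAll-true-≤B : ∀ {n} (x : B n) → andAll x ≡ true → ones ≤B x
andAll-true-≤B [] _ = _
andAll-true-≤B (true ∷ x) all = id , andAll-true-≤B x all

andAll-false-≤B : ∀ {n} (x : B n) → andAll x ≡ false → ∃ λ i → x ≤B (ones [ i ]≔ false)
andAll-false-≤B (false ∷ x) _ = zero , id , ≤B-ones x
andAll-false-≤B (true ∷ x) notAll = let i , x≤hole = andAll-false-≤B x notAll in suc i , id , x≤hole

⟨_∣_∣_⟩ : ∀ {A : Set} {m} → A → Vec A m → A → Vec A (suc (suc m))
⟨ x₁ ∣ xs ∣ xₙ ⟩ = x₁ ∷ (xs ∷ʳ xₙ)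

data Framed {A : Set} {m : ℕ} : Vec A (suc (suc m)) → Set where
  framed : ∀ x₁ xs xₙ → Framed ⟨ x₁ ∣ xs ∣ xₙ ⟩

frame-view : ∀ {A : Set} {m} (x : Vec A (suc (suc m))) → Framed x
frame-view (x₁ ∷ rest) with initLast rest
... | xs , xₙ , refl = framed x₁ xs xₙ

replicate-frame : ∀ {A : Set} m (a : A) → replicate (suc (suc m)) a ≡ ⟨ a ∣ replicate m a ∣ a ⟩
replicate-frame m a = cong (a ∷_) (replicate-∷ʳ m a)

module _ {A : Set} {m} (x₁ : A) (xs : Vec A m) (xₙ : A) where

  lookup-frame-middle : ∀ j → lookup ⟨ x₁ ∣ xs ∣ xₙ ⟩ (suc (inject₁ j)) ≡ lookup xs j
  lookup-frame-middle = lookup-∷ʳ-inject₁ xs xₙ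

  lookup-frame-last : lookup ⟨ x₁ ∣ xs ∣ xₙ ⟩ (suc (fromℕ m)) ≡ xₙ
  lookup-frame-last = lookup-∷ʳ-fromℕ xs xₙ

  []≔-frame-middle : ∀ j y → ⟨ x₁ ∣ xs ∣ xₙ ⟩ [ suc (inject₁ j) ]≔ y ≡ ⟨ x₁ ∣ xs [ j ]≔ y ∣ xₙ ⟩
  []≔-frame-middle j y = cong (x₁ ∷_) ([]≔-∷ʳ-inject₁ xs xₙ j y)

  []≔-frame-last : ∀ y → ⟨ x₁ ∣ xs ∣ xₙ ⟩ [ suc (fromℕ m) ]≔ y ≡ ⟨ x₁ ∣ xs ∣ y ⟩
  []≔-frame-last y = cong (x₁ ∷_) ([]≔-∷ʳ-fromℕ xs xₙ y)

frame-injective : ∀ {A : Set} {m} {x₁ y₁ xₙ yₙ : A} {xs ys : Vec A m} →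
  ⟨ x₁ ∣ xs ∣ xₙ ⟩ ≡ ⟨ y₁ ∣ ys ∣ yₙ ⟩ → x₁ ≡ y₁ × xs ≡ ys × xₙ ≡ yₙ
frame-injective {xs = xs} {ys} eq with Vecₚ.∷-injective eq
... | refl , eq′ = refl , Vecₚ.∷ʳ-injective xs ys eq′

frame-≤B : ∀ {m} {x₁ y₁ xₙ yₙ} {xs ys : B m} →
  (x₁ ≡ true → y₁ ≡ true) → xs ≤B ys → (xₙ ≡ true → yₙ ≡ true) → ⟨ x₁ ∣ xs ∣ xₙ ⟩ ≤B ⟨ y₁ ∣ ys ∣ yₙ ⟩
frame-≤B x₁≤y₁ xs≤ys xₙ≤yₙ = x₁≤y₁ , ≤B-∷ʳ xs≤ys xₙ≤yₙ

dot-∷ʳ : ∀ {n} (w : Vec ℚ n) c (x : B n) b → dot (w ∷ʳ c) (x ∷ʳ b) ≡ dot w x + (if b then c else 0ℚ)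
dot-∷ʳ [] c [] b = trans (ℚₚ.+-identityʳ (if b then c else 0ℚ)) (sym (ℚₚ.+-identityˡ (if b then c else 0ℚ)))
dot-∷ʳ (v ∷ w) c (a ∷ x) b =
  trans (cong ((if a then v else 0ℚ) +_) (dot-∷ʳ w c x b)) (sym (ℚₚ.+-assoc (if a then v else 0ℚ) (dot w x) _))

dot-frame : ∀ {m} a (w : Vec ℚ m) l x₁ (x : B m) xₙ →
  dot ⟨ a ∣ w ∣ l ⟩ ⟨ x₁ ∣ x ∣ xₙ ⟩ ≡ (if x₁ then a else 0ℚ) + (dot w x + (if xₙ then l else 0ℚ))
dot-frame a w l x₁ x xₙ = cong ((if x₁ then a else 0ℚ) +_) (dot-∷ʳ w l x xₙ)

dot-zeros : ∀ {n} (w : Vec ℚ n) → dot w zeros ≡ 0ℚ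
dot-zeros [] = refl
dot-zeros (v ∷ w) = trans (ℚₚ.+-identityˡ (dot w zeros)) (dot-zeros w)

dot-[]≔ : ∀ {n} (w : Vec ℚ n) (x : B n) i → dot w (x [ i ]≔ true) ≡ lookup w i + dot w (x [ i ]≔ false)
dot-[]≔ (v ∷ w) (a ∷ x) zero = cong (v +_) (sym (ℚₚ.+-identityˡ (dot w x)))
dot-[]≔ (v ∷ w) (a ∷ x) (suc i) =
  trans (cong ((if a then v else 0ℚ) +_) (dot-[]≔ w x i)) (x∙yz≈y∙xz (if a then v else 0ℚ) (lookup w i) _)

dot-unit : ∀ {n} (w : Vec ℚ n) i → dot w (unit i) ≡ lookup w i
dot-unit w i = begin
  dot w (unit i)                           ≡⟨ dot-[]≔ w zeros i ⟩
  lookup w i + dot w (zeros [ i ]≔ false)  ≡⟨ cong (λ x → lookup w i + dot w x) (replicate-[]≔ _ false i) ⟩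
  lookup w i + dot w zeros                 ≡⟨ cong (lookup w i +_) (dot-zeros w) ⟩
  lookup w i + 0ℚ                          ≡⟨ ℚₚ.+-identityʳ (lookup w i) ⟩
  lookup w i                               ∎
  where open ≡-Reasoning

dot-ones : ∀ {n} (w : Vec ℚ n) i → dot w ones ≡ lookup w i + dot w (ones [ i ]≔ false)
dot-ones w i = trans (cong (dot w) (sym (replicate-[]≔ _ true i))) (dot-[]≔ w ones i)

dot-monotone : ∀ {n} {w : Vec ℚ n} → All (0ℚ ≤ℚ_) w → ∀ {x y} → x ≤B y → dot w x ≤ℚ dot w y
dot-monotone [] {[]} {[]} _ = ℚₚ.≤-refl
dot-monotone {w = v ∷ w} (0≤v ∷ 0≤w) {a ∷ x} {b ∷ y} (a≤b , x≤y) =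
  ℚₚ.+-mono-≤ (summand a b a≤b) (dot-monotone 0≤w x≤y)
  where
  summand : ∀ a b → (a ≡ true → b ≡ true) → (if a then v else 0ℚ) ≤ℚ (if b then v else 0ℚ)
  summand false false _ = ℚₚ.≤-refl
  summand false true _ = 0≤v
  summand true true _ = ℚₚ.≤-refl
  summand true false a≤b with a≤b refl
  ... | ()

dot-nonneg : ∀ {n} {w : Vec ℚ n} → All (0ℚ ≤ℚ_) w → ∀ x → 0ℚ ≤ℚ dot w x
dot-nonneg {w = w} 0≤w x = subst (_≤ℚ dot w x) (dot-zeros w) (dot-monotone 0≤w (≤B-zeros x))

≥1⇒≥0 : ∀ {n} {w : Vec ℚ n} → All (1ℚ ≤ℚ_) w → All (0ℚ ≤ℚ_) w
≥1⇒≥0 = All.map (ℚₚ.≤-trans decide-≤)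

dot-gap : ∀ {n} {w : Vec ℚ n} → All (1ℚ ≤ℚ_) w → ∀ {x y} → x ≤B y → x ≢ y → 1ℚ + dot w x ≤ℚ dot w y
dot-gap [] {[]} {[]} _ []≢[] = contradiction refl []≢[]
dot-gap {w = v ∷ w} (_ ∷ 1≤w) {true ∷ x} {true ∷ y} (_ , x≤y) x≢y =
  1+-monoʳ-≤ v (dot w x) (dot-gap 1≤w x≤y (x≢y ∘ cong (true ∷_)))
dot-gap {w = v ∷ w} (_ ∷ 1≤w) {false ∷ x} {false ∷ y} (_ , x≤y) x≢y =
  1+-monoʳ-≤ 0ℚ (dot w x) (dot-gap 1≤w x≤y (x≢y ∘ cong (false ∷_)))
dot-gap {w = v ∷ w} (1≤v ∷ 1≤w) {false ∷ x} {true ∷ y} (_ , x≤y) _ =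
  ℚₚ.+-mono-≤ 1≤v (ℚₚ.≤-trans (ℚₚ.≤-reflexive (ℚₚ.+-identityˡ (dot w x))) (dot-monotone (≥1⇒≥0 1≤w) x≤y))
dot-gap {w = v ∷ w} _ {true ∷ x} {false ∷ y} (a≤b , _) _ with a≤b refl
... | ()

dot-strictMono : ∀ {n} {w : Vec ℚ n} → All (1ℚ ≤ℚ_) w → ∀ {x y} → x ≤B y → x ≢ y → dot w x <ℚ dot w y
dot-strictMono {w = w} 1≤w {x} x≤y x≢y = ℚₚ.<-≤-trans x<1+x (dot-gap 1≤w x≤y x≢y)
  where
  x<1+x : dot w x <ℚ 1ℚ + dot w x
  x<1+x = subst (_<ℚ 1ℚ + dot w x) (ℚₚ.+-identityˡ (dot w x)) (ℚₚ.+-monoˡ-< (dot w x) (decide-< {0ℚ} {1ℚ}))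

-- Separation by a hyperplane

record Separates {n} (w : Vec ℚ n) (t : ℚ) (g : BoolFun n) : Set where
  constructor separation
  field false⇔below : ∀ x → (g x ≡ false) ⇔ (dot w x ≤ℚ t)
open Separates

separates⇒threshold : ∀ {n} {w : Vec ℚ n} {t g} → Separates w t g → IsThreshold g
separates⇒threshold {w = w} {t} sep = w , t , false⇔below sep

module _ {n} {w : Vec ℚ n} {t : ℚ} {g : BoolFun n} where

  separates-intro : (∀ x → g x ≡ true → t <ℚ dot w x) → (∀ x → g x ≡ false → dot w x ≤ℚ t) → Separates w t g
  separates-intro above below = separation λ x → mk⇔ (below x) (not-above x)
    where
    not-above : ∀ x → dot w x ≤ℚ t → g x ≡ false
    not-above x x≤t with g x in gx
    ... | false = refl
    ... | true = contradiction x≤t (<⇒≱ (above x gx))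

  separates-false : Separates w t g → ∀ {x} → g x ≡ false → dot w x ≤ℚ t
  separates-false sep {x} = Equivalence.to (false⇔below sep x)

  separates-true : Separates w t g → ∀ {x} → g x ≡ true → t <ℚ dot w x
  separates-true sep {x} gx =
    ℚₚ.≰⇒> (λ x≤t → contradiction (trans (sym gx) (Equivalence.from (false⇔below sep x) x≤t)) λ ())

  separates-above : Separates w t g → ∀ {x} → t <ℚ dot w x → g x ≡ true
  separates-above sep t<x = ¬-not (λ gx → <⇒≱ t<x (separates-false sep gx))

  separates-positive : All (0ℚ ≤ℚ_) w → Separates w t g → IsPositive g
  separates-positive 0≤w sep x y x≤y gx =
    separates-above sep (ℚₚ.<-≤-trans (separates-true sep gx) (dot-monotone 0≤w x≤y))

separates-unique : ∀ {n} {w : Vec ℚ n} {t g h} → Separates w t g → Separates w t h → g ≗f h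
separates-unique {g = g} sg sh x with g x in gx
... | true = sym (separates-above sh (separates-true sg gx))
... | false = sym (Equivalence.from (false⇔below sh x) (separates-false sg gx))

_≟ᴮ_ : ∀ {n} (x y : B n) → Dec (x ≡ y)
_≟ᴮ_ = Vecₚ.≡-dec Boolₚ._≟_

flipAt : ∀ {n} → B n → BoolFun n → BoolFun n
flipAt p g x = if does (x ≟ᴮ p) then not (g x) else g x

flipAt-≢ : ∀ {n} {p x : B n} (g : BoolFun n) → x ≢ p → flipAt p g x ≡ g x
flipAt-≢ {p = p} {x} g x≢p with x ≟ᴮ p
... | yes x≡p = contradiction x≡p x≢p
... | no _ = refl

flipAt-self : ∀ {n} (p : B n) g → flipAt p g p ≢ g p
flipAt-self p g with p ≟ᴮ p
... | yes _ = not-¬ refl ∘ sym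
... | no p≢p = contradiction refl p≢p

module _ {n} {w : Vec ℚ n} {t : ℚ} {g : BoolFun n} {p : B n} (sep : Separates w t g) where

  flip-true-separates : g p ≡ true → (∀ x → g x ≡ true → x ≢ p → dot w p <ℚ dot w x) →
    Separates w (dot w p) (flipAt p g)
  flip-true-separates gp above-p = separates-intro above below
    where
    above : ∀ x → flipAt p g x ≡ true → dot w p <ℚ dot w x
    above x fx with x ≟ᴮ p
    ... | yes refl = contradiction (trans (cong not (sym gp)) fx) λ ()
    ... | no x≢p = above-p x fx x≢p
    below : ∀ x → flipAt p g x ≡ false → dot w x ≤ℚ dot w p
    below x fx with x ≟ᴮ p
    ... | yes refl = ℚₚ.≤-refl
    ... | no _ = ℚₚ.<⇒≤ (ℚₚ.≤-<-trans (separates-false sep fx) (separates-true sep gp))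

  flip-false-separates : ∀ {t′} → g p ≡ false → t′ <ℚ dot w p → (∀ x → g x ≡ false → x ≢ p → dot w x ≤ℚ t′) →
    Separates w t′ (flipAt p g)
  flip-false-separates {t′} gp t′<p below-t′ = separates-intro above below
    where
    above : ∀ x → flipAt p g x ≡ true → t′ <ℚ dot w x
    above x fx with x ≟ᴮ p
    ... | yes refl = t′<p
    ... | no _ = ℚₚ.<-trans t′<p (ℚₚ.≤-<-trans (separates-false sep gp) (separates-true sep fx))
    below : ∀ x → flipAt p g x ≡ false → dot w x ≤ℚ t′
    below x fx with x ≟ᴮ p
    ... | yes refl = contradiction (trans (cong not (sym gp)) fx) λ ()
    ... | no x≢p = below-t′ x fx x≢p

-- Specifying sets and nested formulas

∈-─ : ∀ {A : Set} {x y : A} {xs} (x∈xs : x ∈ xs) → y ∈ xs → y ≢ x → y ∈ (xs ─ x∈xs)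
∈-─ (here refl) (here refl) y≢x = contradiction refl y≢x
∈-─ (here refl) (there y∈xs) _ = y∈xs
∈-─ (there x∈xs) (here refl) _ = here refl
∈-─ (there x∈xs) (there y∈xs) y≢x = there (∈-─ x∈xs y∈xs y≢x)

unique-⊆-length : ∀ {A : Set} {xs ys : List A} → Unique xs → (∀ {x} → x ∈ xs → x ∈ ys) → length xs ≤ length ys
unique-⊆-length {xs = []} _ _ = z≤n
unique-⊆-length {xs = x ∷ xs} {ys} (x∉xs ∷ xs-unique) xs⊆ys =
  subst (suc (length xs) ≤_) (sym (length-removeAt′ ys (index x∈ys))) (s≤s (unique-⊆-length xs-unique xs⊆ys─x))
  where
  x∈ys = xs⊆ys (here refl)
  xs⊆ys─x : ∀ {y} → y ∈ xs → y ∈ (ys ─ x∈ys)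
  xs⊆ys─x y∈xs = ∈-─ x∈ys (xs⊆ys (there y∈xs)) (λ y≡x → ListAll.lookup x∉xs y∈xs (sym y≡x))

-- Flipping f at p ∈ S stays in C, so every set specifying f in C must contain p.
essential-points-bound : ∀ {n} {C : BoolFun n → Set} {f} {S : List (B n)} → Unique S →
  (∀ {p} → p ∈ S → C (flipAt p f)) → ∀ S′ → Specifies C S′ f → length S ≤ length S′
essential-points-bound {f = f} {S} S-unique flip∈C S′ S′-specifies = unique-⊆-length S-unique essential
  where
  essential : ∀ {p} → p ∈ S → p ∈ S′
  essential {p} p∈S with any? (p ≟ᴮ_) S′
  ... | yes p∈S′ = p∈S′
  ... | no p∉S′ = contradiction (S′-specifies (flipAt p f) (flip∈C p∈S) agree p) (flipAt-self p f)
    where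
    agree : ∀ x → x ∈ S′ → flipAt p f x ≡ f x
    agree x x∈S′ = flipAt-≢ f (λ x≡p → p∉S′ (subst (_∈ S′) x≡p x∈S′))

-- A nested formula is a literal x or x̄, alone or joined to the rest by ∨ or ∧; each of these six shapes
-- contradicts one of the hypotheses.
¬linearReadOnce : ∀ {n} (f : BoolFun n) → f zeros ≡ false → f ones ≡ true →
  (∀ i → f (unit i) ≡ false) → (∀ i → ∃ λ x → lookup x i ≡ false × f x ≡ true) → ¬ IsLinearReadOnce f
¬linearReadOnce f f0 f1 f-unit f-hole (inj₁ (c , f≡c)) = contradiction true≡false λ ()
  where
  open ≡-Reasoning
  true≡false : true ≡ false
  true≡false = begin true ≡⟨ f1 ⟨ f ones ≡⟨ f≡c ones ⟩ c ≡⟨ f≡c zeros ⟨ f zeros ≡⟨ f0 ⟩ false ∎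
¬linearReadOnce {n} f f0 f1 f-unit f-hole (inj₂ (φ , _ , f≗φ)) = top-literal φ f≗φ
  where
  clash : ∀ {x b} → f x ≡ b → f x ≡ not b → ⊥
  clash = not-¬
  unit-i : ∀ i → lookup (unit {n} i) i ≡ true
  unit-i i = Vecₚ.lookup∘update i zeros true
  top-literal : ∀ φ → f ≗f eval φ → ⊥
  top-literal (lit i true) f≗ = clash (f-unit i) (trans (f≗ _) (unit-i i))
  top-literal (lit i false) f≗ = clash f0 (trans (f≗ _) (cong not (Vecₚ.lookup-replicate i false)))
  top-literal (node i true OR t) f≗ = clash (f-unit i) (trans (f≗ _) (cong (_∨ eval t (unit i)) (unit-i i)))
  top-literal (node i true AND t) f≗ with f-hole i
  ... | x , xᵢ≡false , fx = clash fx (trans (f≗ x) (cong (_∧ eval t x) xᵢ≡false))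
  top-literal (node i false OR t) f≗ =
    clash f0 (trans (f≗ _) (cong (λ b → not b ∨ eval t zeros) (Vecₚ.lookup-replicate i false)))
  top-literal (node i false AND t) f≗ =
    clash f1 (trans (f≗ _) (cong (λ b → not b ∧ eval t ones) (Vecₚ.lookup-replicate i true)))

-- The function f, with n = m + 2

𝐀 𝐄 : ∀ {m} → Fin m → B (suc (suc m))
𝐀 i = ⟨ true ∣ unit i ∣ false ⟩
𝐄 i = ⟨ false ∣ ones [ i ]≔ false ∣ true ⟩

𝐁 𝐂 𝐃 : ∀ {m} → B (suc (suc m))
𝐁 = ⟨ false ∣ ones ∣ true ⟩
𝐂 = ⟨ true ∣ zeros ∣ true ⟩
𝐃 = ⟨ false ∣ ones ∣ false ⟩

fn-frame : ∀ {m} x₁ (xs : B m) xₙ → fn (suc (suc m)) ⟨ x₁ ∣ xs ∣ xₙ ⟩ ≡ (x₁ ∧ orAll xs) ∨ (andAll xs ∧ xₙ)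
fn-frame x₁ xs xₙ = cong₂ (λ o a → (x₁ ∧ o) ∨ a) (orInit-∷ʳ xs xₙ) (andAll-∷ʳ xs xₙ)

fn-𝐀 : ∀ {m} (i : Fin m) → fn (suc (suc m)) (𝐀 i) ≡ true
fn-𝐀 i = trans (fn-frame true (unit i) false) (cong (_∨ (andAll (unit i) ∧ false)) (orAll-unit i))

fn-𝐁 : ∀ {m} → fn (suc (suc m)) 𝐁 ≡ true
fn-𝐁 {m} = trans (fn-frame false (ones {m}) true) (cong (_∧ true) (andAll-ones m))

fn-false-false : ∀ {m} (xs : B m) → fn (suc (suc m)) ⟨ false ∣ xs ∣ false ⟩ ≡ false
fn-false-false xs = trans (fn-frame false xs false) (∧-zeroʳ (andAll xs))

fn-true-zeros : ∀ {m} xₙ → fn (suc (suc (suc m))) ⟨ true ∣ zeros ∣ xₙ ⟩ ≡ false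
fn-true-zeros {m} xₙ = trans (fn-frame true (zeros {suc m}) xₙ) (cong (_∨ false) (orAll-zeros m))

fn-true-above : ∀ {m} x → fn (suc (suc m)) x ≡ true → (∃ λ i → 𝐀 i ≤B x) ⊎ 𝐁 ≤B x
fn-true-above x fx with frame-view x
... | framed x₁ xs xₙ = above x₁ xₙ (trans (sym (fn-frame x₁ xs xₙ)) fx)
  where
  𝐁-below : ∀ {x₁ xₙ} → andAll xs ∧ xₙ ≡ true → 𝐁 ≤B ⟨ x₁ ∣ xs ∣ xₙ ⟩
  𝐁-below all∧xₙ = frame-≤B (λ ()) (andAll-true-≤B xs (∧-conicalˡ _ _ all∧xₙ)) (λ _ → ∧-conicalʳ _ _ all∧xₙ)
  above : ∀ x₁ xₙ → (x₁ ∧ orAll xs) ∨ (andAll xs ∧ xₙ) ≡ true →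
    (∃ λ i → 𝐀 i ≤B ⟨ x₁ ∣ xs ∣ xₙ ⟩) ⊎ 𝐁 ≤B ⟨ x₁ ∣ xs ∣ xₙ ⟩
  above true xₙ h with orAll xs in any
  ... | true = let i , uᵢ≤xs = orAll-true-≤B xs any in inj₁ (i , frame-≤B id uᵢ≤xs (λ ()))
  ... | false = inj₂ (𝐁-below h)
  above false xₙ h = inj₂ (𝐁-below h)

fn-false-below : ∀ {m} x → fn (suc (suc m)) x ≡ false → x ≤B 𝐂 ⊎ x ≤B 𝐃 ⊎ ∃ λ i → x ≤B 𝐄 i
fn-false-below x fx with frame-view x
... | framed x₁ xs xₙ = below x₁ xₙ (trans (sym (fn-frame x₁ xs xₙ)) fx)
  where
  below : ∀ x₁ xₙ → (x₁ ∧ orAll xs) ∨ (andAll xs ∧ xₙ) ≡ false →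
    ⟨ x₁ ∣ xs ∣ xₙ ⟩ ≤B 𝐂 ⊎ ⟨ x₁ ∣ xs ∣ xₙ ⟩ ≤B 𝐃 ⊎ ∃ λ i → ⟨ x₁ ∣ xs ∣ xₙ ⟩ ≤B 𝐄 i
  below true xₙ h = inj₁ (frame-≤B id (orAll-false-≤B xs (∨-conicalˡ _ _ h)) (λ _ → refl))
  below false false h = inj₂ (inj₁ (frame-≤B id (≤B-ones xs) id))
  below false true h =
    let i , xs≤hole = andAll-false-≤B xs (trans (sym (∧-identityʳ _)) h) in inj₂ (inj₂ (i , frame-≤B id xs≤hole id))

module _ {m} {w : Vec ℚ (suc (suc (suc m)))} where

  fn-separated : ∀ {t} → All (0ℚ ≤ℚ_) w →
    (∀ i → t <ℚ dot w (𝐀 i)) → t <ℚ dot w 𝐁 → dot w 𝐂 ≤ℚ t → dot w 𝐃 ≤ℚ t → (∀ i → dot w (𝐄 i) ≤ℚ t) →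
    Separates w t (fn (suc (suc (suc m))))
  fn-separated {t} 0≤w t<𝐀 t<𝐁 𝐂≤t 𝐃≤t 𝐄≤t = separates-intro above below
    where
    above : ∀ x → fn _ x ≡ true → t <ℚ dot w x
    above x fx with fn-true-above x fx
    ... | inj₁ (i , 𝐀≤x) = ℚₚ.<-≤-trans (t<𝐀 i) (dot-monotone 0≤w 𝐀≤x)
    ... | inj₂ 𝐁≤x = ℚₚ.<-≤-trans t<𝐁 (dot-monotone 0≤w 𝐁≤x)
    below : ∀ x → fn _ x ≡ false → dot w x ≤ℚ t
    below x fx with fn-false-below x fx
    ... | inj₁ x≤𝐂 = ℚₚ.≤-trans (dot-monotone 0≤w x≤𝐂) 𝐂≤t
    ... | inj₂ (inj₁ x≤𝐃) = ℚₚ.≤-trans (dot-monotone 0≤w x≤𝐃) 𝐃≤t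
    ... | inj₂ (inj₂ (i , x≤𝐄)) = ℚₚ.≤-trans (dot-monotone 0≤w x≤𝐄) (𝐄≤t i)

  module _ {t} (1≤w : All (1ℚ ≤ℚ_) w) (sep : Separates w t (fn (suc (suc (suc m))))) where

    flip-𝐀-separates : ∀ j → (∀ i → i ≢ j → dot w (𝐀 j) <ℚ dot w (𝐀 i)) → dot w (𝐀 j) <ℚ dot w 𝐁 →
      Separates w (dot w (𝐀 j)) (flipAt (𝐀 j) (fn _))
    flip-𝐀-separates j 𝐀ⱼ<𝐀 𝐀ⱼ<𝐁 = flip-true-separates sep (fn-𝐀 j) above
      where
      above : ∀ x → fn _ x ≡ true → x ≢ 𝐀 j → dot w (𝐀 j) <ℚ dot w x
      above x fx x≢𝐀ⱼ with fn-true-above x fx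
      ... | inj₂ 𝐁≤x = ℚₚ.<-≤-trans 𝐀ⱼ<𝐁 (dot-monotone (≥1⇒≥0 1≤w) 𝐁≤x)
      ... | inj₁ (i , 𝐀ᵢ≤x) with i Finₚ.≟ j
      ...   | yes refl = dot-strictMono 1≤w 𝐀ᵢ≤x (x≢𝐀ⱼ ∘ sym)
      ...   | no i≢j = ℚₚ.<-≤-trans (𝐀ⱼ<𝐀 i i≢j) (dot-monotone (≥1⇒≥0 1≤w) 𝐀ᵢ≤x)

    flip-𝐁-separates : (∀ i → dot w 𝐁 <ℚ dot w (𝐀 i)) → Separates w (dot w 𝐁) (flipAt 𝐁 (fn _))
    flip-𝐁-separates 𝐁<𝐀 = flip-true-separates sep (fn-𝐁 {suc m}) above
      where
      above : ∀ x → fn _ x ≡ true → x ≢ 𝐁 → dot w 𝐁 <ℚ dot w x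
      above x fx x≢𝐁 with fn-true-above x fx
      ... | inj₁ (i , 𝐀ᵢ≤x) = ℚₚ.<-≤-trans (𝐁<𝐀 i) (dot-monotone (≥1⇒≥0 1≤w) 𝐀ᵢ≤x)
      ... | inj₂ 𝐁≤x = dot-strictMono 1≤w 𝐁≤x (x≢𝐁 ∘ sym)

    below-by-gap : ∀ {x p t′} → x ≤B p → x ≢ p → dot w p ≤ℚ 1ℚ + t′ → dot w x ≤ℚ t′
    below-by-gap x≤p x≢p p≤1+t′ = +-cancelˡ-≤ 1ℚ (ℚₚ.≤-trans (dot-gap 1≤w x≤p x≢p) p≤1+t′)

    flip-𝐂-separates : ∀ {t′} → t′ <ℚ dot w 𝐂 → dot w 𝐂 ≤ℚ 1ℚ + t′ →
      dot w 𝐃 ≤ℚ t′ → (∀ i → dot w (𝐄 i) ≤ℚ t′) → Separates w t′ (flipAt 𝐂 (fn _))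
    flip-𝐂-separates {t′} t′<𝐂 𝐂≤1+t′ 𝐃≤t′ 𝐄≤t′ = flip-false-separates sep (fn-true-zeros {m} true) t′<𝐂 below
      where
      below : ∀ x → fn _ x ≡ false → x ≢ 𝐂 → dot w x ≤ℚ t′
      below x fx x≢𝐂 with fn-false-below x fx
      ... | inj₁ x≤𝐂 = below-by-gap x≤𝐂 x≢𝐂 𝐂≤1+t′
      ... | inj₂ (inj₁ x≤𝐃) = ℚₚ.≤-trans (dot-monotone (≥1⇒≥0 1≤w) x≤𝐃) 𝐃≤t′
      ... | inj₂ (inj₂ (i , x≤𝐄)) = ℚₚ.≤-trans (dot-monotone (≥1⇒≥0 1≤w) x≤𝐄) (𝐄≤t′ i)

    flip-𝐃-separates : ∀ {t′} → t′ <ℚ dot w 𝐃 → dot w 𝐃 ≤ℚ 1ℚ + t′ →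
      dot w 𝐂 ≤ℚ t′ → (∀ i → dot w (𝐄 i) ≤ℚ t′) → Separates w t′ (flipAt 𝐃 (fn _))
    flip-𝐃-separates {t′} t′<𝐃 𝐃≤1+t′ 𝐂≤t′ 𝐄≤t′ = flip-false-separates sep (fn-false-false (ones {suc m})) t′<𝐃 below
      where
      below : ∀ x → fn _ x ≡ false → x ≢ 𝐃 → dot w x ≤ℚ t′
      below x fx x≢𝐃 with fn-false-below x fx
      ... | inj₁ x≤𝐂 = ℚₚ.≤-trans (dot-monotone (≥1⇒≥0 1≤w) x≤𝐂) 𝐂≤t′
      ... | inj₂ (inj₁ x≤𝐃) = below-by-gap x≤𝐃 x≢𝐃 𝐃≤1+t′
      ... | inj₂ (inj₂ (i , x≤𝐄)) = ℚₚ.≤-trans (dot-monotone (≥1⇒≥0 1≤w) x≤𝐄) (𝐄≤t′ i)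

module Layout {m} (a : ℚ) (ws : Vec ℚ m) (l : ℚ) where

  dot-𝐀 : ∀ i → dot ⟨ a ∣ ws ∣ l ⟩ (𝐀 i) ≡ a + lookup ws i
  dot-𝐀 i = trans (dot-frame a ws l true (unit i) false)
                  (cong (a +_) (trans (ℚₚ.+-identityʳ (dot ws (unit i))) (dot-unit ws i)))

  dot-𝐁 : dot ⟨ a ∣ ws ∣ l ⟩ 𝐁 ≡ dot ws ones + l
  dot-𝐁 = trans (dot-frame a ws l false ones true) (ℚₚ.+-identityˡ (dot ws ones + l))

  dot-𝐂 : dot ⟨ a ∣ ws ∣ l ⟩ 𝐂 ≡ a + l
  dot-𝐂 = trans (dot-frame a ws l true zeros true)
                (cong (a +_) (trans (cong (_+ l) (dot-zeros ws)) (ℚₚ.+-identityˡ l)))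

  dot-𝐃 : dot ⟨ a ∣ ws ∣ l ⟩ 𝐃 ≡ dot ws ones
  dot-𝐃 = trans (dot-frame a ws l false ones false)
                (trans (ℚₚ.+-identityˡ (dot ws ones + 0ℚ)) (ℚₚ.+-identityʳ (dot ws ones)))

  dot-𝐄-≤ : ∀ {t} i → dot ws ones + l ≤ℚ lookup ws i + t → dot ⟨ a ∣ ws ∣ l ⟩ (𝐄 i) ≤ℚ t
  dot-𝐄-≤ {t} i 𝐃+l≤wᵢ+t = +-cancelˡ-≤ (lookup ws i) (begin
    lookup ws i + dot ⟨ a ∣ ws ∣ l ⟩ (𝐄 i)  ≡⟨ cong (lookup ws i +_) 𝐄≡ρ+l ⟩
    lookup ws i + (ρ + l)                   ≡⟨ ℚₚ.+-assoc (lookup ws i) ρ l ⟨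
    (lookup ws i + ρ) + l                   ≡⟨ cong (_+ l) (dot-ones ws i) ⟨
    dot ws ones + l                         ≤⟨ 𝐃+l≤wᵢ+t ⟩
    lookup ws i + t                         ∎)
    where
    open ℚₚ.≤-Reasoning
    ρ = dot ws (ones [ i ]≔ false)
    𝐄≡ρ+l : dot ⟨ a ∣ ws ∣ l ⟩ (𝐄 i) ≡ ρ + l
    𝐄≡ρ+l = trans (dot-frame a ws l false (ones [ i ]≔ false) true) (ℚₚ.+-identityˡ (ρ + l))

-- A hyperplane realising f on the specifying set has nonnegative weights and l < wᵢ, hence also realises f.
module Forced {m} {a l t : ℚ} {ws : Vec ℚ (suc m)}
  (t<𝐀 : ∀ i → t <ℚ a + lookup ws i) (t<𝐁 : t <ℚ dot ws ones + l)
  (𝐂≤t : a + l ≤ℚ t) (𝐃≤t : dot ws ones ≤ℚ t) where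

  open Layout a ws l

  0<l : 0ℚ <ℚ l
  0<l = +-cancelˡ-< (dot ws ones)
    (subst (_<ℚ dot ws ones + l) (sym (ℚₚ.+-identityʳ (dot ws ones))) (ℚₚ.≤-<-trans 𝐃≤t t<𝐁))

  l<wᵢ : ∀ i → l <ℚ lookup ws i
  l<wᵢ i = +-cancelˡ-< a (ℚₚ.≤-<-trans 𝐂≤t (t<𝐀 i))

  0≤ws : All (0ℚ ≤ℚ_) ws
  0≤ws = lookup⁻ (λ i → ℚₚ.<⇒≤ (ℚₚ.<-trans 0<l (l<wᵢ i)))

  0≤a : 0ℚ ≤ℚ a
  0≤a = ℚₚ.≮⇒≥ λ a<0 → <⇒≱ (t<𝐀 zero) (begin
    a + lookup ws zero   ≤⟨ ℚₚ.+-monoˡ-≤ (lookup ws zero) (ℚₚ.<⇒≤ a<0) ⟩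
    0ℚ + lookup ws zero  ≡⟨ ℚₚ.+-identityˡ (lookup ws zero) ⟩
    lookup ws zero       ≡⟨ dot-unit ws zero ⟨
    dot ws (unit zero)   ≤⟨ dot-monotone 0≤ws (≤B-ones (unit zero)) ⟩
    dot ws ones          ≤⟨ 𝐃≤t ⟩
    t                    ∎)
    where open ℚₚ.≤-Reasoning

  fn-separated-by : Separates ⟨ a ∣ ws ∣ l ⟩ t (fn (suc (suc (suc m))))
  fn-separated-by = fn-separated (0≤a ∷ All-∷ʳ 0≤ws (ℚₚ.<⇒≤ 0<l))
    (λ i → subst (t <ℚ_) (sym (dot-𝐀 i)) (t<𝐀 i)) (subst (t <ℚ_) (sym dot-𝐁) t<𝐁)
    (subst (_≤ℚ t) (sym dot-𝐂) 𝐂≤t) (subst (_≤ℚ t) (sym dot-𝐃) 𝐃≤t)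
    (λ i → dot-𝐄-≤ i (ℚₚ.≤-trans (ℚₚ.+-mono-≤ 𝐃≤t (ℚₚ.<⇒≤ (l<wᵢ i))) (ℚₚ.≤-reflexive (ℚₚ.+-comm t (lookup ws i)))))

specifyingSet : ∀ {m} → List (B (suc (suc m)))
specifyingSet = 𝐁 ∷ 𝐂 ∷ 𝐃 ∷ tabulate 𝐀

𝐀∈specifyingSet : ∀ {m} (i : Fin m) → 𝐀 i ∈ specifyingSet
𝐀∈specifyingSet i = there (there (there (∈-tabulate⁺ i)))

fn-specified : ∀ {m} → Specifies IsThreshold (specifyingSet {suc m}) (fn (suc (suc (suc m))))
fn-specified {m} g (w , t , g-sep) agree with frame-view w
... | framed a ws l = separates-unique sep (Forced.fn-separated-by t<𝐀 t<𝐁 𝐂≤t 𝐃≤t)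
  where
  open Layout a ws l
  sep : Separates ⟨ a ∣ ws ∣ l ⟩ t g
  sep = separation g-sep
  t<𝐀 : ∀ i → t <ℚ a + lookup ws i
  t<𝐀 i = subst (t <ℚ_) (dot-𝐀 i) (separates-true sep (trans (agree _ (𝐀∈specifyingSet i)) (fn-𝐀 i)))
  t<𝐁 : t <ℚ dot ws ones + l
  t<𝐁 = subst (t <ℚ_) dot-𝐁 (separates-true sep (trans (agree _ (here refl)) (fn-𝐁 {suc m})))
  𝐂≤t : a + l ≤ℚ t
  𝐂≤t = subst (_≤ℚ t) dot-𝐂 (separates-false sep (trans (agree _ (there (here refl))) (fn-true-zeros {m} true)))
  𝐃≤t : dot ws ones ≤ℚ t
  𝐃≤t = subst (_≤ℚ t) dot-𝐃
    (separates-false sep (trans (agree _ (there (there (here refl)))) (fn-false-false (ones {suc m}))))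

-- Weights under which one point of the specifying set is extreme

-- R is chosen so that 𝐀 i, 𝐁, 𝐂 and 𝐃 all weigh R plus a constant.
module Family {m} (j : Fin m) (α b v l : ℚ) where

  middle : Vec ℚ m
  middle = replicate m b [ j ]≔ v

  R : ℚ
  R = dot middle (ones [ j ]≔ false)

  weights : Vec ℚ (suc (suc m))
  weights = ⟨ R + α ∣ middle ∣ l ⟩

  private module L = Layout (R + α) middle l

  middle-j : lookup middle j ≡ v
  middle-j = Vecₚ.lookup∘update j (replicate m b) v

  middle-≢ : ∀ {i} → i ≢ j → lookup middle i ≡ b
  middle-≢ {i} i≢j = trans (Vecₚ.lookup∘update′ i≢j (replicate m b) v) (Vecₚ.lookup-replicate i b)

  middle-sum : dot middle ones ≡ R + v
  middle-sum = trans (dot-ones middle j) (trans (cong (_+ R) middle-j) (ℚₚ.+-comm v R))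

  dot-𝐀ⱼ : dot weights (𝐀 j) ≡ R + (α + v)
  dot-𝐀ⱼ = trans (L.dot-𝐀 j) (trans (cong (R + α +_) middle-j) (ℚₚ.+-assoc R α v))

  dot-𝐀ᵢ : ∀ {i} → i ≢ j → dot weights (𝐀 i) ≡ R + (α + b)
  dot-𝐀ᵢ {i} i≢j = trans (L.dot-𝐀 i) (trans (cong (R + α +_) (middle-≢ i≢j)) (ℚₚ.+-assoc R α b))

  dot-𝐁 : dot weights 𝐁 ≡ R + (v + l)
  dot-𝐁 = trans L.dot-𝐁 (trans (cong (_+ l) middle-sum) (ℚₚ.+-assoc R v l))

  dot-𝐂 : dot weights 𝐂 ≡ R + (α + l)
  dot-𝐂 = trans L.dot-𝐂 (ℚₚ.+-assoc R α l)

  dot-𝐃 : dot weights 𝐃 ≡ R + v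
  dot-𝐃 = trans L.dot-𝐃 middle-sum

  dot-𝐄-≤ : ∀ {τ} → v + l ≤ℚ v + τ → v + l ≤ℚ b + τ → ∀ i → dot weights (𝐄 i) ≤ℚ R + τ
  dot-𝐄-≤ {τ} v+l≤v+τ v+l≤b+τ i = L.dot-𝐄-≤ i (begin
    dot middle ones + l        ≡⟨ cong (_+ l) middle-sum ⟩
    (R + v) + l                ≡⟨ ℚₚ.+-assoc R v l ⟩
    R + (v + l)                ≤⟨ ℚₚ.+-monoʳ-≤ R v+l≤wᵢ+τ ⟩
    R + (lookup middle i + τ)  ≡⟨ x∙yz≈y∙xz R (lookup middle i) τ ⟩
    lookup middle i + (R + τ)  ∎)
    where
    open ℚₚ.≤-Reasoning
    v+l≤wᵢ+τ : v + l ≤ℚ lookup middle i + τ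
    v+l≤wᵢ+τ with i Finₚ.≟ j
    ... | yes refl = subst (λ w → v + l ≤ℚ w + τ) (sym middle-j) v+l≤v+τ
    ... | no i≢j = subst (λ w → v + l ≤ℚ w + τ) (sym (middle-≢ i≢j)) v+l≤b+τ

  gapped : 1ℚ ≤ℚ α → 1ℚ ≤ℚ b → 1ℚ ≤ℚ v → 1ℚ ≤ℚ l → All (1ℚ ≤ℚ_) weights
  gapped 1≤α 1≤b 1≤v 1≤l = 1≤R+α ∷ All-∷ʳ 1≤middle 1≤l
    where
    1≤middle : All (1ℚ ≤ℚ_) middle
    1≤middle = lookup⁻ 1≤wᵢ
      where
      1≤wᵢ : ∀ i → 1ℚ ≤ℚ lookup middle i
      1≤wᵢ i with i Finₚ.≟ j
      ... | yes refl = subst (1ℚ ≤ℚ_) (sym middle-j) 1≤v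
      ... | no i≢j = subst (1ℚ ≤ℚ_) (sym (middle-≢ i≢j)) 1≤b
    1≤R+α : 1ℚ ≤ℚ R + α
    1≤R+α = subst (_≤ℚ R + α) (ℚₚ.+-identityˡ 1ℚ) (ℚₚ.+-mono-≤ (dot-nonneg (≥1⇒≥0 1≤middle) _) 1≤α)

-- 𝐀 i, 𝐁, 𝐂, 𝐃 weigh R + 7, 6, 5, 4: 𝐁 is the unique lightest true point and 𝐂 the unique heaviest false one.
module Uniform (m : ℕ) where
  open Family {suc m} zero (ι 3) (ι 4) (ι 4) (ι 2)

  gaps : All (1ℚ ≤ℚ_) weights
  gaps = gapped decide-≤ decide-≤ decide-≤ decide-≤

  dot-𝐀 : ∀ i → dot weights (𝐀 i) ≡ R + (ι 3 + ι 4)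
  dot-𝐀 i with i Finₚ.≟ zero
  ... | yes refl = dot-𝐀ⱼ
  ... | no i≢0 = dot-𝐀ᵢ i≢0

  separates-fn : Separates weights (R + ι 5) (fn (suc (suc (suc m))))
  separates-fn = fn-separated (≥1⇒≥0 gaps) (λ i → offset-< R refl (dot-𝐀 i)) (offset-< R refl dot-𝐁)
    (offset-≤ R dot-𝐂 refl) (offset-≤ R dot-𝐃 refl) (dot-𝐄-≤ decide-≤ decide-≤)

  flip-𝐁 : IsThreshold (flipAt 𝐁 (fn (suc (suc (suc m)))))
  flip-𝐁 = separates⇒threshold (flip-𝐁-separates gaps separates-fn (λ i → offset-< R dot-𝐁 (dot-𝐀 i)))

  flip-𝐂 : IsThreshold (flipAt 𝐂 (fn (suc (suc (suc m)))))
  flip-𝐂 = separates⇒threshold (flip-𝐂-separates gaps separates-fn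
    (offset-< R refl dot-𝐂) (offset-≤ R dot-𝐂 (x∙yz≈y∙xz 1ℚ R (ι 4)))
    (offset-≤ R dot-𝐃 refl) (dot-𝐄-≤ decide-≤ decide-≤))

-- 𝐀 j, the other 𝐀 i, 𝐁, 𝐂, 𝐃 weigh R + 6, 7, 8, 4, 5: 𝐀 j is the unique lightest true point and 𝐃 the
-- unique heaviest false one.
module Pointed {m} (j : Fin (suc m)) where
  open Family j (ι 1) (ι 6) (ι 5) (ι 3)

  gaps : All (1ℚ ≤ℚ_) weights
  gaps = gapped decide-≤ decide-≤ decide-≤ decide-≤

  separates-fn : Separates weights (R + ι 5) (fn (suc (suc (suc m))))
  separates-fn = fn-separated (≥1⇒≥0 gaps) t<𝐀 (offset-< R refl dot-𝐁)
    (offset-≤ R dot-𝐂 refl) (offset-≤ R dot-𝐃 refl) (dot-𝐄-≤ decide-≤ decide-≤)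
    where
    t<𝐀 : ∀ i → R + ι 5 <ℚ dot weights (𝐀 i)
    t<𝐀 i with i Finₚ.≟ j
    ... | yes refl = offset-< R refl dot-𝐀ⱼ
    ... | no i≢j = offset-< R refl (dot-𝐀ᵢ i≢j)

  flip-𝐀 : IsThreshold (flipAt (𝐀 j) (fn (suc (suc (suc m)))))
  flip-𝐀 = separates⇒threshold (flip-𝐀-separates gaps separates-fn j
    (λ i i≢j → offset-< R dot-𝐀ⱼ (dot-𝐀ᵢ i≢j)) (offset-< R dot-𝐀ⱼ dot-𝐁))

  flip-𝐃 : IsThreshold (flipAt 𝐃 (fn (suc (suc (suc m)))))
  flip-𝐃 = separates⇒threshold (flip-𝐃-separates gaps separates-fn
    (offset-< R refl dot-𝐃) (offset-≤ R dot-𝐃 (x∙yz≈y∙xz 1ℚ R (ι 4)))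
    (offset-≤ R dot-𝐂 refl) (dot-𝐄-≤ decide-≤ decide-≤))

flipAt-threshold : ∀ {m} {p} → p ∈ specifyingSet {suc m} → IsThreshold (flipAt p (fn (suc (suc (suc m)))))
flipAt-threshold {m} (here refl) = Uniform.flip-𝐁 m
flipAt-threshold {m} (there (here refl)) = Uniform.flip-𝐂 m
flipAt-threshold (there (there (here refl))) = Pointed.flip-𝐃 zero
flipAt-threshold (there (there (there p∈𝐀))) with ∈-tabulate⁻ {f = 𝐀} p∈𝐀
... | j , refl = Pointed.flip-𝐀 j

specifyingSet-unique : ∀ {m} → Unique (specifyingSet {m})
specifyingSet-unique =
    ((λ ()) ListAll.∷ 𝐁≢𝐃 ListAll.∷ ListAllₚ.tabulate⁺ (λ i ()))
  ∷ ((λ ()) ListAll.∷ ListAllₚ.tabulate⁺ 𝐂≢𝐀)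
  ∷ ListAllₚ.tabulate⁺ (λ i ())
  ∷ Uniqueₚ.tabulate⁺ (unit-injective ∘ proj₁ ∘ proj₂ ∘ frame-injective)
  where
  𝐁≢𝐃 : 𝐁 ≢ 𝐃
  𝐁≢𝐃 𝐁≡𝐃 with () ← proj₂ (proj₂ (frame-injective 𝐁≡𝐃))
  𝐂≢𝐀 : ∀ i → 𝐂 ≢ 𝐀 i
  𝐂≢𝐀 i 𝐂≡𝐀 with () ← proj₂ (proj₂ (frame-injective 𝐂≡𝐀))

length-specifyingSet : ∀ {m} → length (specifyingSet {m}) ≡ suc (suc (suc m))
length-specifyingSet = cong (λ k → suc (suc (suc k))) (length-tabulate 𝐀)

toggle⇒relevant : ∀ {n} (f : BoolFun n) {k} x → f (x [ k ]≔ true) ≡ true → f (x [ k ]≔ false) ≡ false → Relevant f k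
toggle⇒relevant f x on off same = contradiction (trans (sym on) (trans (same x) off)) λ ()

fn-dependsOnAll : ∀ {m} → DependsOnAll (fn (suc (suc (suc m))))
fn-dependsOnAll {m} zero = toggle⇒relevant (fn _) (𝐀 zero) (fn-𝐀 {suc m} zero) (fn-false-false (unit {suc m} zero))
fn-dependsOnAll {m} (suc k) with view k
... | ‵inject₁ j = toggle⇒relevant (fn _) ⟨ true ∣ zeros ∣ false ⟩
  (trans (cong (fn _) ([]≔-frame-middle true zeros false j true)) (fn-𝐀 j))
  (trans (cong (fn _) (trans ([]≔-frame-middle true zeros false j false)
                             (cong (λ xs → ⟨ true ∣ xs ∣ false ⟩) (replicate-[]≔ _ false j))))
         (fn-true-zeros {m} false))
... | ‵fromℕ = toggle⇒relevant (fn _) 𝐃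
  (trans (cong (fn _) ([]≔-frame-last false (ones {suc m}) false true)) (fn-𝐁 {suc m}))
  (trans (cong (fn _) ([]≔-frame-last false (ones {suc m}) false false)) (fn-false-false (ones {suc m})))

fn-¬linearReadOnce : ∀ {m} → ¬ IsLinearReadOnce (fn (suc (suc (suc (suc m)))))
fn-¬linearReadOnce {m} = ¬linearReadOnce (fn _) refl refl fn-unit fn-hole
  where
  framed-unit : ∀ i → fn _ (⟨ false ∣ zeros ∣ false ⟩ [ i ]≔ true) ≡ false
  framed-unit zero = fn-true-zeros {suc m} false
  framed-unit (suc k) with view k
  ... | ‵inject₁ j = trans (cong (fn _) ([]≔-frame-middle false zeros false j true)) (fn-false-false (unit j))
  ... | ‵fromℕ = cong (fn _) ([]≔-frame-last false (zeros {suc (suc m)}) false true)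
  fn-unit : ∀ i → fn _ (unit i) ≡ false
  fn-unit i = trans (cong (λ z → fn _ (z [ i ]≔ true)) (replicate-frame (suc (suc m)) false)) (framed-unit i)
  other : Fin (suc (suc m)) → Fin (suc (suc m))
  other zero = suc zero
  other (suc _) = zero
  other-≢ : ∀ j → j ≢ other j
  other-≢ zero ()
  other-≢ (suc j) ()
  fn-hole : ∀ i → ∃ λ x → lookup x i ≡ false × fn _ x ≡ true
  fn-hole zero = 𝐁 , refl , fn-𝐁 {suc (suc m)}
  fn-hole (suc k) with view k
  ... | ‵inject₁ j =
    𝐀 (other j) , trans (lookup-frame-middle true (unit (other j)) false j) (lookup-unit-≢ (other-≢ j)) , fn-𝐀 (other j)
  ... | ‵fromℕ = 𝐀 zero , lookup-frame-last true (unit {suc (suc m)} zero) false , fn-𝐀 {suc (suc m)} zero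

theorem5 : (n : ℕ) → 4 ≤ n →
    IsPositive (fn n) × IsThreshold (fn n) × DependsOnAll (fn n)
    × ¬ IsLinearReadOnce (fn n) × ¬ IsNested (fn n)
    × SpecNumber IsThreshold (fn n) (suc n)
theorem5 (suc (suc (suc (suc m)))) _ =
    separates-positive (≥1⇒≥0 U.gaps) U.separates-fn
  , separates⇒threshold U.separates-fn
  , fn-dependsOnAll
  , fn-¬linearReadOnce
  , fn-¬linearReadOnce ∘ proj₁
  , (specifyingSet , specifyingSet-unique , length-specifyingSet , fn-specified)
  , λ S _ S-specifies → subst (_≤ length S) length-specifyingSet
                          (essential-points-bound specifyingSet-unique flipAt-threshold S S-specifies)
  where module U = Uniform (suc m)
theorem5 zero ()
theorem5 (suc zero) (s≤s ())
theorem5 (suc (suc zero)) (s≤s (s≤s ()))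
theorem5 (suc (suc (suc zero))) (s≤s (s≤s (s≤s ())))
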